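{- Let $S$ be a finite set of clauses with unary predicates. Assume every clause of $S$ is either (Ca) a ground clause, or (Cb) a clause whose only variable is $x_1$, occurring in it, each of whose literals has the form $\pm P(t[x_1])$ with $t$ non-ground and reduced. Define the following sets. - $\mathsf{Ng}$ is the set of non-ground terms occurring as arguments of literals in $S$, together with $x_1$. - $\mathsf{Ngs}$ is the set of non-ground subterms of terms in $\mathsf{Ng}$, together with $x_1$. - $\mathsf{G}$ is the set of ground subterms of arguments of literals in $S$. - $S^\dagger$ is the set of all clauses of type (Ca) or (Cb) all of whose literals are of the form $\pm P(t)$ with $t\in\mathsf{Ng}\cup\mathsf{Ng}[\mathsf{Ngs}[\mathsf{G}]]$. Then binary ordered resolution and ordered factorization, with respect to the subterm ordering, applied to clauses in $S^\dagger$ produce clauses that are again in $S^\dagger$ up to renaming.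
   Context: A clause is a finite set (disjunction) of literals $\pm A$. A term is ground if it has no variables, and trivial if it has no function symbols. A non-ground term $t[x]$ with at most the variable $x$ is reduced if it is not of the form $u[v[x]]$ with $u[x]$, $v[x]$ non-ground, non-trivial, one-variable terms. For a set $N$ of terms and a set $M$ of terms in the variable $x_1$, $M[N]=\{m[n]\mid m\in M,n\in N\}$, where $m[n]$ replaces $x_1$ by $n$. The subterm ordering is $P(s)\prec Q(t)$ iff $s$ is a strict subterm of $t$. A literal $\pm A$ is maximal in a clause $C$ if there is no literal $\pm' B\in C$ with $A\prec B$. Binary ordered resolution: from $C_1\lor A$ and $-B\lor C_2$ (renamed apart) derive $C_1\sigma\lor C_2\sigma$, where $\sigma=\mathrm{mgu}(A,B)$, $A$ is maximal in $C_1\lor A$, and $B$ is maximal in $-B\lor C_2$. Ordered factorization: from $C_1\lor\pm A\lor\pm B$ derive $C_1\sigma\lor\pm A\sigma$, where $\sigma=\mathrm{mgu}(A,B)$ and $A$, $B$ are both maximal in the premise. -}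

module Defs where

open import Data.Nat using (ℕ; zero; suc)
open import Data.Vec using (Vec; []; _∷_)
open import Data.Vec.Relation.Unary.Any using (Any)
open import Data.List using (List; map)
open import Data.List.Membership.Propositional using (_∈_)
open import Data.Product using (Σ; ∃; _×_; _,_; ∃-syntax)
open import Data.Sum using (_⊎_)
open import Relation.Binary.PropositionalEquality using (_≡_; _≢_)
open import Relation.Nullary using (¬_)

record Signature : Set₁ where
  field
    Fun   : Set
    arity : Fun → ℕ
    Pred  : Set
open Signature public

Var : Set
Var = ℕ

x₁ : Var
x₁ = 1

data Term (Sig : Signature) : Set where
  var : Var → Term Sig
  fun : (f : Fun Sig) → Vec (Term Sig) (arity Sig f) → Term Sig

record Atom (Sig : Signature) : Set where
  constructor _⦅_⦆
  field
    pred : Pred Sig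
    arg  : Term Sig
open Atom public

data Sign : Set where
  pos neg : Sign

record Literal (Sig : Signature) : Set where
  constructor lit
  field
    sign : Sign
    atom : Atom Sig
open Literal public

-- A clause is a finite set of literals, represented by a list read as a set
-- (only membership matters below).
Clause : Signature → Set
Clause Sig = List (Literal Sig)

module _ {Sig : Signature} where

  infix 8 _⟨_⟩ _⟨_⟩* _⟨_⟩ᵃ _⟨_⟩ˡ _⟨_⟩ᶜ
  infix 4 _≈ᶜ_ _⊑_ _⊏_ _≺_

  Subst : Set
  Subst = Var → Term Sig

  mutual
    _⟨_⟩ : Term Sig → Subst → Term Sig
    var x ⟨ σ ⟩ = σ x
    fun f ts ⟨ σ ⟩ = fun f (ts ⟨ σ ⟩*)

    _⟨_⟩* : ∀ {n} → Vec (Term Sig) n → Subst → Vec (Term Sig) n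
    [] ⟨ σ ⟩* = []
    (t ∷ ts) ⟨ σ ⟩* = (t ⟨ σ ⟩) ∷ (ts ⟨ σ ⟩*)

  _⟨_⟩ᵃ : Atom Sig → Subst → Atom Sig
  (P ⦅ t ⦆) ⟨ σ ⟩ᵃ = P ⦅ t ⟨ σ ⟩ ⦆

  _⟨_⟩ˡ : Literal Sig → Subst → Literal Sig
  lit s A ⟨ σ ⟩ˡ = lit s (A ⟨ σ ⟩ᵃ)

  _⟨_⟩ᶜ : Clause Sig → Subst → Clause Sig
  C ⟨ σ ⟩ᶜ = map (λ L → L ⟨ σ ⟩ˡ) C

  sub₁ : Term Sig → Subst
  sub₁ n zero = var zero
  sub₁ n (suc zero) = n
  sub₁ n (suc (suc k)) = var (suc (suc k))

  _[_] : Term Sig → Term Sig → Term Sig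
  m [ n ] = m ⟨ sub₁ n ⟩

  _[_]ˢ : (Term Sig → Set) → (Term Sig → Set) → (Term Sig → Set)
  (M [ N ]ˢ) t = ∃[ m ] ∃[ n ] (M m × N n × t ≡ m [ n ])

  data _⊑_ (s : Term Sig) : Term Sig → Set where
    ⊑-refl : s ⊑ s
    ⊑-arg  : ∀ {f ts} → Any (s ⊑_) ts → s ⊑ fun f ts

  data _⊏_ (s : Term Sig) : Term Sig → Set where
    ⊏-arg : ∀ {f ts} → Any (s ⊑_) ts → s ⊏ fun f ts

  Occurs : Var → Term Sig → Set
  Occurs x t = var x ⊑ t

  Ground : Term Sig → Set
  Ground t = ∀ x → ¬ Occurs x t

  NonGround : Term Sig → Set
  NonGround t = ∃[ x ] Occurs x t

  Trivial : Term Sig → Set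
  Trivial t = ∃[ x ] (t ≡ var x)

  OnlyVar : Var → Term Sig → Set
  OnlyVar x t = ∀ y → Occurs y t → y ≡ x

  NGNT₁ : Term Sig → Set
  NGNT₁ u = NonGround u × ¬ Trivial u × OnlyVar x₁ u

  Reduced : Term Sig → Set
  Reduced t = ¬ (∃[ u ] ∃[ v ] (NGNT₁ u × NGNT₁ v × t ≡ u [ v ]))

  OccursC : Var → Clause Sig → Set
  OccursC x C = ∃[ L ] (L ∈ C × Occurs x (arg (atom L)))

  Ca : Clause Sig → Set
  Ca C = ∀ L → L ∈ C → Ground (arg (atom L))

  Cb : Clause Sig → Set
  Cb C = OccursC x₁ C
       × (∀ L → L ∈ C → OnlyVar x₁ (arg (atom L))
                       × NonGround (arg (atom L))
                       × Reduced (arg (atom L)))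

  ArgOf : List (Clause Sig) → Term Sig → Set
  ArgOf S t = ∃[ C ] ∃[ L ] (C ∈ S × L ∈ C × arg (atom L) ≡ t)

  Ng : List (Clause Sig) → Term Sig → Set
  Ng S t = t ≡ var x₁ ⊎ (NonGround t × ArgOf S t)

  Ngs : List (Clause Sig) → Term Sig → Set
  Ngs S t = t ≡ var x₁ ⊎ (NonGround t × ∃[ u ] (Ng S u × t ⊑ u))

  G : List (Clause Sig) → Term Sig → Set
  G S t = Ground t × ∃[ u ] (ArgOf S u × t ⊑ u)

  AllowedArg : List (Clause Sig) → Term Sig → Set
  AllowedArg S t = Ng S t ⊎ (Ng S [ Ngs S [ G S ]ˢ ]ˢ) t

  S† : List (Clause Sig) → Clause Sig → Set
  S† S C = (Ca C ⊎ Cb C) × (∀ L → L ∈ C → AllowedArg S (arg (atom L)))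

  _≺_ : Atom Sig → Atom Sig → Set
  A ≺ B = arg A ⊏ arg B

  Maximal : Atom Sig → Clause Sig → Set
  Maximal A C = ∀ L → L ∈ C → ¬ (A ≺ atom L)

  Unifier : Subst → Atom Sig → Atom Sig → Set
  Unifier σ A B = A ⟨ σ ⟩ᵃ ≡ B ⟨ σ ⟩ᵃ

  IsMGU : Subst → Atom Sig → Atom Sig → Set
  IsMGU σ A B = Unifier σ A B
              × (∀ θ → Unifier θ A B → ∃[ δ ] (∀ x → θ x ≡ (σ x) ⟨ δ ⟩))

  _≈ᶜ_ : Clause Sig → Clause Sig → Set
  C ≈ᶜ D = ∀ L → (L ∈ C → L ∈ D) × (L ∈ D → L ∈ C)

  RenamingOf : Clause Sig → Clause Sig → Set
  RenamingOf C D = Σ (Var → Var) λ ρ → ((∀ x y → ρ x ≡ ρ y → x ≡ y)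
                          × C ≈ᶜ D ⟨ (λ x → var (ρ x)) ⟩ᶜ)

  RenamedApart : Clause Sig → Clause Sig → Set
  RenamedApart C D = ∀ x → OccursC x C → ¬ OccursC x D

  -- R is a binary ordered resolvent of C = C₁ ∨ A and D = ¬B ∨ C₂:
  -- R = C₁σ ∨ C₂σ with σ = mgu(A,B), A maximal in C, B maximal in D.
  Resolvent : Clause Sig → Clause Sig → Clause Sig → Set
  Resolvent C D R =
    ∃[ A ] ∃[ B ] ∃[ σ ]
      ( lit pos A ∈ C × lit neg B ∈ D
      × Maximal A C × Maximal B D
      × IsMGU σ A B
      × (∀ L → (L ∈ R →
                  (∃[ L′ ] (L′ ∈ C × L′ ≢ lit pos A × L ≡ L′ ⟨ σ ⟩ˡ))
                ⊎ (∃[ L′ ] (L′ ∈ D × L′ ≢ lit neg B × L ≡ L′ ⟨ σ ⟩ˡ)))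
             × ((∃[ L′ ] (L′ ∈ C × L′ ≢ lit pos A × L ≡ L′ ⟨ σ ⟩ˡ))
                ⊎ (∃[ L′ ] (L′ ∈ D × L′ ≢ lit neg B × L ≡ L′ ⟨ σ ⟩ˡ))
                → L ∈ R)))

  -- R is an ordered factor of C = C₁ ∨ ±A ∨ ±B: R = C₁σ ∨ ±Aσ with
  -- σ = mgu(A,B), A and B maximal in C.
  Factor : Clause Sig → Clause Sig → Set
  Factor C R =
    ∃[ s ] ∃[ A ] ∃[ B ] ∃[ σ ]
      ( lit s A ∈ C × lit s B ∈ C
      × Maximal A C × Maximal B C
      × IsMGU σ A B
      × (∀ L → (L ∈ R →
                  (∃[ L′ ] (L′ ∈ C × L′ ≢ lit s A × L′ ≢ lit s B × L ≡ L′ ⟨ σ ⟩ˡ))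
                ⊎ L ≡ lit s (A ⟨ σ ⟩ᵃ))
             × ((∃[ L′ ] (L′ ∈ C × L′ ≢ lit s A × L′ ≢ lit s B × L ≡ L′ ⟨ σ ⟩ˡ))
                ⊎ L ≡ lit s (A ⟨ σ ⟩ᵃ)
                → L ∈ R)))

  InS†UpToRenaming : List (Clause Sig) → Clause Sig → Set
  InS†UpToRenaming S R = ∃[ D ] (S† S D × RenamingOf R D)

-- An argument of a clause of S† is either an element of Ng, hence a reduced term in x₁
-- (Cb clauses), or a ground term m[r] with m ∈ Ng and r ∈ Ngs[G] (Ca clauses). Unifying
-- two selected arguments t ρ and s ρ′ amounts to an equation t σ₁ = s σ₂ between terms
-- in x₁. Comparing both sides position by position, either σ₁ x₁ is a strict subterm
-- of σ₂ x₁, or σ₂ x₁ is a ground subterm of t or s, or s = t[m′] and σ₁ x₁ = m′ σ₂ for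
-- a subterm m′ of s. Reducedness excludes a non-trivial m′ inside a non-trivial t, and
-- what remains shows that the mgu either sends the variable of each premise into
-- Ngs[G], making the conclusion a Ca clause of S†, or sends both to one variable z,
-- making it a Cb clause of S† after exchanging z and x₁. The only exception is a selected
-- literal P(x₁): maximality then forces every literal of its premise to be of that form,
-- so its instances are instances of the other selected atom.

module Submission where

open import Defs
open import Data.Nat using (ℕ; suc; _+_; _≤_; _≟_; s≤s)
open import Data.Nat.Properties using (≤-refl; ≤-trans; m≤m+n; m≤n+m; <-irrefl; m≤n⇒m≤1+n)
open import Data.Vec using (Vec; []; _∷_)
open import Data.Vec.Relation.Unary.Any using (Any; here; there)
open import Data.List using (List; []; _∷_)
open import Data.List.Properties using (map-∘; map-cong; map-id)
open import Data.List.Relation.Unary.Any using () renaming (here to hereˡ)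
open import Data.List.Membership.Propositional using (_∈_)
open import Data.List.Membership.Propositional.Properties using (∈-map⁻)
open import Data.Product using (_×_; _,_; ∃-syntax; proj₁; proj₂; swap; map₂; uncurry)
open import Data.Sum using (_⊎_; inj₁; inj₂; [_,_]′) renaming (map to ⊎-map; swap to ⊎-swap)
open import Data.Empty using (⊥-elim)
open import Function using (_∘_; case_of_)
open import Relation.Nullary using (¬_; Dec; yes; no)
open import Relation.Binary.PropositionalEquality
  using (_≡_; _≢_; refl; sym; trans; cong; cong₂; subst; module ≡-Reasoning)

module _ {Sig : Signature} where

  private
    Tm : Set
    Tm = Term Sig

  mutual
    size : Tm → ℕ
    size (var x)    = 1
    size (fun f ts) = suc (size* ts)

    size* : ∀ {n} → Vec Tm n → ℕ
    size* []       = 0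
    size* (t ∷ ts) = size t + size* ts

  mutual
    ⊑⇒size≤ : ∀ {s t : Tm} → s ⊑ t → size s ≤ size t
    ⊑⇒size≤ ⊑-refl    = ≤-refl
    ⊑⇒size≤ (⊑-arg a) = m≤n⇒m≤1+n (⊑*⇒size≤ a)

    ⊑*⇒size≤ : ∀ {s : Tm} {n} {ts : Vec Tm n} → Any (s ⊑_) ts → size s ≤ size* ts
    ⊑*⇒size≤ {ts = t ∷ ts} (here p)  = ≤-trans (⊑⇒size≤ p) (m≤m+n (size t) (size* ts))
    ⊑*⇒size≤ {ts = t ∷ ts} (there a) = ≤-trans (⊑*⇒size≤ a) (m≤n+m (size* ts) (size t))

  ⊏-irrefl : ∀ {s : Tm} → ¬ (s ⊏ s)
  ⊏-irrefl (⊏-arg a) = <-irrefl refl (s≤s (⊑*⇒size≤ a))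

  mutual
    ⊑-trans : ∀ {s t u : Tm} → s ⊑ t → t ⊑ u → s ⊑ u
    ⊑-trans p ⊑-refl    = p
    ⊑-trans p (⊑-arg a) = ⊑-arg (⊑-trans* p a)

    ⊑-trans* : ∀ {s t : Tm} {n} {us : Vec Tm n} → s ⊑ t → Any (t ⊑_) us → Any (s ⊑_) us
    ⊑-trans* p (here q)  = here (⊑-trans p q)
    ⊑-trans* p (there a) = there (⊑-trans* p a)

  ⊏⇒⊑ : ∀ {s t : Tm} → s ⊏ t → s ⊑ t
  ⊏⇒⊑ (⊏-arg a) = ⊑-arg a

  ⊏-⊑-trans : ∀ {s t u : Tm} → s ⊏ t → t ⊑ u → s ⊏ u
  ⊏-⊑-trans p ⊑-refl    = p
  ⊏-⊑-trans p (⊑-arg a) = ⊏-arg (⊑-trans* (⊏⇒⊑ p) a)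

  ⊑-var : ∀ {u : Tm} {x} → u ⊑ var x → u ≡ var x
  ⊑-var ⊑-refl = refl

  ⊑-¬⊏⇒≡ : ∀ {s t : Tm} → s ⊑ t → ¬ (s ⊏ t) → t ≡ s
  ⊑-¬⊏⇒≡ ⊑-refl    _  = refl
  ⊑-¬⊏⇒≡ (⊑-arg a) ¬⊏ = ⊥-elim (¬⊏ (⊏-arg a))

  mutual
    occurs? : ∀ x (t : Tm) → Dec (Occurs x t)
    occurs? x (var y) with x ≟ y
    ... | yes refl = yes ⊑-refl
    ... | no x≢y   = no λ { ⊑-refl → x≢y refl }
    occurs? x (fun f ts) with occurs*? x ts
    ... | yes a = yes (⊑-arg a)
    ... | no ¬a = no λ { (⊑-arg a) → ¬a a }

    occurs*? : ∀ x {n} (ts : Vec Tm n) → Dec (Any (Occurs x) ts)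
    occurs*? x []       = no λ ()
    occurs*? x (t ∷ ts) with occurs? x t | occurs*? x ts
    ... | yes p | _     = yes (here p)
    ... | no _  | yes a = yes (there a)
    ... | no ¬p | no ¬a = no λ { (here p) → ¬p p ; (there a) → ¬a a }

  mutual
    ⟨⟩-cong : ∀ (t : Tm) {σ τ : Subst} → (∀ x → Occurs x t → σ x ≡ τ x) → t ⟨ σ ⟩ ≡ t ⟨ τ ⟩
    ⟨⟩-cong (var x)    eq = eq x ⊑-refl
    ⟨⟩-cong (fun f ts) eq = cong (fun f) (⟨⟩*-cong ts λ x o → eq x (⊑-arg o))

    ⟨⟩*-cong : ∀ {n} (ts : Vec Tm n) {σ τ : Subst}
             → (∀ x → Any (Occurs x) ts → σ x ≡ τ x) → ts ⟨ σ ⟩* ≡ ts ⟨ τ ⟩*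
    ⟨⟩*-cong []       eq = refl
    ⟨⟩*-cong (t ∷ ts) eq = cong₂ _∷_ (⟨⟩-cong t λ x o → eq x (here o)) (⟨⟩*-cong ts λ x o → eq x (there o))

  mutual
    ⟨var⟩ : ∀ (t : Tm) → t ⟨ var ⟩ ≡ t
    ⟨var⟩ (var x)    = refl
    ⟨var⟩ (fun f ts) = cong (fun f) (⟨var⟩* ts)

    ⟨var⟩* : ∀ {n} (ts : Vec Tm n) → ts ⟨ var ⟩* ≡ ts
    ⟨var⟩* []       = refl
    ⟨var⟩* (t ∷ ts) = cong₂ _∷_ (⟨var⟩ t) (⟨var⟩* ts)

  infixl 9 _⨟_

  _⨟_ : Subst {Sig} → Subst {Sig} → Subst {Sig}
  (σ ⨟ τ) x = σ x ⟨ τ ⟩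

  rename : (Var → Var) → Subst {Sig}
  rename ρ x = var (ρ x)

  mutual
    ⟨⟩-∘ : ∀ (t : Tm) {σ τ : Subst} → t ⟨ σ ⟩ ⟨ τ ⟩ ≡ t ⟨ σ ⨟ τ ⟩
    ⟨⟩-∘ (var x)    = refl
    ⟨⟩-∘ (fun f ts) = cong (fun f) (⟨⟩*-∘ ts)

    ⟨⟩*-∘ : ∀ {n} (ts : Vec Tm n) {σ τ : Subst} → ts ⟨ σ ⟩* ⟨ τ ⟩* ≡ ts ⟨ σ ⨟ τ ⟩*
    ⟨⟩*-∘ []       = refl
    ⟨⟩*-∘ (t ∷ ts) = cong₂ _∷_ (⟨⟩-∘ t) (⟨⟩*-∘ ts)

  ground⇒⟨⟩-id : ∀ (t : Tm) {σ : Subst} → Ground t → t ⟨ σ ⟩ ≡ t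
  ground⇒⟨⟩-id t g = trans (⟨⟩-cong t λ x o → ⊥-elim (g x o)) (⟨var⟩ t)

  mutual
    occurs⇒⊑⟨⟩ : ∀ {x} {t : Tm} (σ : Subst) → Occurs x t → σ x ⊑ t ⟨ σ ⟩
    occurs⇒⊑⟨⟩ σ ⊑-refl    = ⊑-refl
    occurs⇒⊑⟨⟩ σ (⊑-arg a) = ⊑-arg (occurs*⇒⊑⟨⟩ σ a)

    occurs*⇒⊑⟨⟩ : ∀ {x n} {ts : Vec Tm n} (σ : Subst) → Any (Occurs x) ts → Any (σ x ⊑_) (ts ⟨ σ ⟩*)
    occurs*⇒⊑⟨⟩ {ts = t ∷ ts} σ (here p)  = here (occurs⇒⊑⟨⟩ σ p)
    occurs*⇒⊑⟨⟩ {ts = t ∷ ts} σ (there a) = there (occurs*⇒⊑⟨⟩ σ a)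

  mutual
    ⊑⟨⟩⁻ : ∀ {a : Tm} (t : Tm) (τ : Subst) → a ⊑ t ⟨ τ ⟩
         → (∃[ t′ ] (t′ ⊑ t × a ≡ t′ ⟨ τ ⟩)) ⊎ (∃[ z ] (Occurs z t × a ⊑ τ z))
    ⊑⟨⟩⁻ (var z)    τ p = inj₂ (z , ⊑-refl , p)
    ⊑⟨⟩⁻ (fun f ts) τ ⊑-refl = inj₁ (fun f ts , ⊑-refl , refl)
    ⊑⟨⟩⁻ (fun f ts) τ (⊑-arg a) with ⊑⟨⟩*⁻ ts τ a
    ... | inj₁ (t′ , q , e) = inj₁ (t′ , ⊑-arg q , e)
    ... | inj₂ (z , q , p)  = inj₂ (z , ⊑-arg q , p)

    ⊑⟨⟩*⁻ : ∀ {a : Tm} {n} (ts : Vec Tm n) (τ : Subst) → Any (a ⊑_) (ts ⟨ τ ⟩*)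
          → (∃[ t′ ] (Any (t′ ⊑_) ts × a ≡ t′ ⟨ τ ⟩)) ⊎ (∃[ z ] (Any (Occurs z) ts × a ⊑ τ z))
    ⊑⟨⟩*⁻ (t ∷ ts) τ (here p) with ⊑⟨⟩⁻ t τ p
    ... | inj₁ (t′ , q , e) = inj₁ (t′ , here q , e)
    ... | inj₂ (z , q , p′) = inj₂ (z , here q , p′)
    ⊑⟨⟩*⁻ (t ∷ ts) τ (there a) with ⊑⟨⟩*⁻ ts τ a
    ... | inj₁ (t′ , q , e) = inj₁ (t′ , there q , e)
    ... | inj₂ (z , q , p′) = inj₂ (z , there q , p′)

  x₁-only-⟨⟩-cong : ∀ (t : Tm) {σ τ : Subst} → OnlyVar x₁ t → σ x₁ ≡ τ x₁ → t ⟨ σ ⟩ ≡ t ⟨ τ ⟩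
  x₁-only-⟨⟩-cong t {σ} {τ} only eq = ⟨⟩-cong t λ x o → subst (λ y → σ y ≡ τ y) (sym (only x o)) eq

  [var-x₁] : ∀ (t : Tm) → t [ var x₁ ] ≡ t
  [var-x₁] t = trans (⟨⟩-cong t λ { 0 _ → refl ; 1 _ → refl ; (suc (suc k)) _ → refl }) (⟨var⟩ t)

  OnlyVar-⊑ : ∀ {x} {s t : Tm} → s ⊑ t → OnlyVar x t → OnlyVar x s
  OnlyVar-⊑ p only y o = only y (⊑-trans o p)

  OnlyVar⇒Ground : ∀ {x} {t : Tm} → OnlyVar x t → ¬ Occurs x t → Ground t
  OnlyVar⇒Ground only ¬o y o with only y o
  ... | refl = ¬o o

  Ground-⟨⟩ : ∀ (t : Tm) {σ : Subst} → OnlyVar x₁ t → Ground (σ x₁) → Ground (t ⟨ σ ⟩)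
  Ground-⟨⟩ t {σ} only g y o with ⊑⟨⟩⁻ t σ o
  ... | inj₁ (var z , z⊑t , e) with only z z⊑t
  ...   | refl = g y (subst (var y ⊑_) e ⊑-refl)
  Ground-⟨⟩ t {σ} only g y o | inj₁ (fun f ts , _ , ())
  Ground-⟨⟩ t {σ} only g y o | inj₂ (z , z⊑t , y⊑σz) with only z z⊑t
  ...   | refl = g y y⊑σz

  OnlyVar* : Var → ∀ {n} → Vec Tm n → Set
  OnlyVar* x ts = ∀ y → Any (Occurs y) ts → y ≡ x

  OnlyVar-args : ∀ {x f} {ts : Vec Tm (arity Sig f)} → OnlyVar x (fun f ts) → OnlyVar* x ts
  OnlyVar-args only y o = only y (⊑-arg o)

  OnlyVar*-head : ∀ {x n t} {ts : Vec Tm n} → OnlyVar* x (t ∷ ts) → OnlyVar x t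
  OnlyVar*-head only y o = only y (here o)

  OnlyVar*-tail : ∀ {x n t} {ts : Vec Tm n} → OnlyVar* x (t ∷ ts) → OnlyVar* x ts
  OnlyVar*-tail only y o = only y (there o)

  private
    fun-injective : ∀ {f g : Fun Sig} {ss : Vec Tm (arity Sig f)} {ts : Vec Tm (arity Sig g)}
                  → fun f ss ≡ fun g ts → ∃[ f≡g ] (subst (λ h → Vec Tm (arity Sig h)) f≡g ss ≡ ts)
    fun-injective refl = refl , refl

    ∷-injective : ∀ {n} {s t : Tm} {ss ts : Vec Tm n} → s ∷ ss ≡ t ∷ ts → s ≡ t × ss ≡ ts
    ∷-injective refl = refl , refl

  mutual
    ⟨⟩-injective-or-ground : (m₁ m₂ : Tm) (τ : Subst) → OnlyVar x₁ m₁ → OnlyVar x₁ m₂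
      → m₁ ⟨ τ ⟩ ≡ m₂ ⟨ τ ⟩ → m₁ ≡ m₂ ⊎ (Ground (τ x₁) × (τ x₁ ⊑ m₁ ⊎ τ x₁ ⊑ m₂))
    ⟨⟩-injective-or-ground (var y₁) (var y₂) τ only₁ only₂ e with only₁ y₁ ⊑-refl | only₂ y₂ ⊑-refl
    ... | refl | refl = inj₁ refl
    ⟨⟩-injective-or-ground (var y) (fun f ms) τ only₁ only₂ e with only₁ y ⊑-refl | occurs*? x₁ ms
    ... | refl | yes a = ⊥-elim (⊏-irrefl (subst (τ x₁ ⊏_) (sym e) (⊏-arg (occurs*⇒⊑⟨⟩ τ a))))
    ... | refl | no ¬a =
          inj₂ (subst (λ u → Ground u × (u ⊑ var x₁ ⊎ u ⊑ fun f ms)) (sym τx₁≡m) (gr , inj₂ ⊑-refl))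
      where gr = OnlyVar⇒Ground only₂ λ { (⊑-arg a) → ¬a a }
            τx₁≡m = trans e (ground⇒⟨⟩-id (fun f ms) gr)
    ⟨⟩-injective-or-ground (fun f ms) (var y) τ only₁ only₂ e
      with ⟨⟩-injective-or-ground (var y) (fun f ms) τ only₂ only₁ (sym e)
    ... | inj₁ ()
    ... | inj₂ (gr , i) = inj₂ (gr , ⊎-swap i)
    ⟨⟩-injective-or-ground (fun f ms₁) (fun g ms₂) τ only₁ only₂ e with fun-injective e
    ... | refl , e* with ⟨⟩*-injective-or-ground ms₁ ms₂ τ (OnlyVar-args only₁) (OnlyVar-args only₂) e*
    ...   | inj₁ refl     = inj₁ refl
    ...   | inj₂ (gr , i) = inj₂ (gr , ⊎-map ⊑-arg ⊑-arg i)

    ⟨⟩*-injective-or-ground : ∀ {n} (ms₁ ms₂ : Vec Tm n) (τ : Subst) → OnlyVar* x₁ ms₁ → OnlyVar* x₁ ms₂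
      → ms₁ ⟨ τ ⟩* ≡ ms₂ ⟨ τ ⟩*
      → ms₁ ≡ ms₂ ⊎ (Ground (τ x₁) × (Any (τ x₁ ⊑_) ms₁ ⊎ Any (τ x₁ ⊑_) ms₂))
    ⟨⟩*-injective-or-ground [] [] τ only₁ only₂ e = inj₁ refl
    ⟨⟩*-injective-or-ground (m₁ ∷ ms₁) (m₂ ∷ ms₂) τ only₁ only₂ e with ∷-injective e
    ... | e₁ , e₂ with ⟨⟩-injective-or-ground m₁ m₂ τ (OnlyVar*-head only₁) (OnlyVar*-head only₂) e₁
    ...   | inj₂ (gr , i) = inj₂ (gr , ⊎-map here here i)
    ...   | inj₁ refl with ⟨⟩*-injective-or-ground ms₁ ms₂ τ (OnlyVar*-tail only₁) (OnlyVar*-tail only₂) e₂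
    ...     | inj₁ refl     = inj₁ refl
    ...     | inj₂ (gr , i) = inj₂ (gr , ⊎-map there there i)

  -- The ways t ⟨ σ ⟩ ≡ m ⟨ τ ⟩ can hold for terms t, m in x₁. Inₜ and Inₘ stand for
  -- "is a subterm of t" and "of m", and Inst m′ for "m is t [ m′ ]", so that the same
  -- type also describes vectors of arguments.
  data Match (σ τ : Subst) (Inₜ Inₘ Inst : Tm → Set) : Set where
    σx₁⊏τx₁      : σ x₁ ⊏ τ x₁ → Match σ τ Inₜ Inₘ Inst
    τx₁-ground   : Ground (τ x₁) → Inₜ (τ x₁) ⊎ Inₘ (τ x₁) → Match σ τ Inₜ Inₘ Inst
    σx₁-instance : ∀ {m′} → Inₘ m′ → σ x₁ ≡ m′ ⟨ τ ⟩ → Inst m′ → Match σ τ Inₜ Inₘ Inst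
    x₁-free      : (∀ m′ → Inst m′) → Match σ τ Inₜ Inₘ Inst

  Match-map : ∀ {σ τ} {Inₜ Inₘ Inst Inₜ′ Inₘ′ Inst′ : Tm → Set}
    → (∀ {g} → Inₜ g → Inₜ′ g) → (∀ {g} → Inₘ g → Inₘ′ g) → (∀ {m′} → Inst m′ → Inst′ m′)
    → Match σ τ Inₜ Inₘ Inst → Match σ τ Inₜ′ Inₘ′ Inst′
  Match-map fₜ fₘ fᵢ (σx₁⊏τx₁ p)         = σx₁⊏τx₁ p
  Match-map fₜ fₘ fᵢ (τx₁-ground gr i)    = τx₁-ground gr (⊎-map fₜ fₘ i)
  Match-map fₜ fₘ fᵢ (σx₁-instance a e w) = σx₁-instance (fₘ a) e (fᵢ w)
  Match-map fₜ fₘ fᵢ (x₁-free w)          = x₁-free λ m′ → fᵢ (w m′)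

  mutual
    match : (t m : Tm) (σ τ : Subst) → OnlyVar x₁ t → OnlyVar x₁ m → t ⟨ σ ⟩ ≡ m ⟨ τ ⟩
          → Match σ τ (_⊑ t) (_⊑ m) (λ m′ → m ≡ t [ m′ ])
    match (var y) m σ τ onlyₜ onlyₘ e with onlyₜ y ⊑-refl
    ... | refl = σx₁-instance ⊑-refl e refl
    match (fun f ts) (var z) σ τ onlyₜ onlyₘ e with onlyₘ z ⊑-refl | occurs*? x₁ ts
    ... | refl | yes a = σx₁⊏τx₁ (subst (σ x₁ ⊏_) e (⊏-arg (occurs*⇒⊑⟨⟩ σ a)))
    ... | refl | no ¬a = τx₁-ground (subst Ground t≡τx₁ gr) (inj₁ (subst (_⊑ fun f ts) t≡τx₁ ⊑-refl))
      where gr = OnlyVar⇒Ground onlyₜ λ { (⊑-arg a) → ¬a a }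
            t≡τx₁ = trans (sym (ground⇒⟨⟩-id (fun f ts) gr)) e
    match (fun f ts) (fun g ms) σ τ onlyₜ onlyₘ e with fun-injective e
    ... | refl , e* = Match-map ⊑-arg ⊑-arg (cong (fun f))
                        (match* ts ms σ τ (OnlyVar-args onlyₜ) (OnlyVar-args onlyₘ) e*)

    match* : ∀ {n} (ts ms : Vec Tm n) (σ τ : Subst) → OnlyVar* x₁ ts → OnlyVar* x₁ ms
           → ts ⟨ σ ⟩* ≡ ms ⟨ τ ⟩*
           → Match σ τ (λ g → Any (g ⊑_) ts) (λ g → Any (g ⊑_) ms) (λ m′ → ms ≡ ts ⟨ sub₁ m′ ⟩*)
    match* [] [] σ τ onlyₜ onlyₘ e = x₁-free λ _ → refl
    match* (t ∷ ts) (m ∷ ms) σ τ onlyₜ onlyₘ e with ∷-injective e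
    ... | e₁ , e₂
        with match t m σ τ (OnlyVar*-head onlyₜ) (OnlyVar*-head onlyₘ) e₁
           | match* ts ms σ τ (OnlyVar*-tail onlyₜ) (OnlyVar*-tail onlyₘ) e₂
    ... | σx₁⊏τx₁ p       | _                = σx₁⊏τx₁ p
    ... | τx₁-ground gr i | _                = τx₁-ground gr (⊎-map here here i)
    ... | _               | σx₁⊏τx₁ p        = σx₁⊏τx₁ p
    ... | _               | τx₁-ground gr i  = τx₁-ground gr (⊎-map there there i)
    ... | x₁-free w₁      | x₁-free w₂       = x₁-free λ m′ → cong₂ _∷_ (w₁ m′) (w₂ m′)
    ... | σx₁-instance a q w₁ | x₁-free w₂   = σx₁-instance (here a) q (cong₂ _∷_ w₁ (w₂ _))
    ... | x₁-free w₁ | σx₁-instance a q w₂   = σx₁-instance (there a) q (cong₂ _∷_ (w₁ _) w₂)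
    -- Two occurrences of x₁ in t face subterms m₁, m₂ of m with m₁ τ ≡ m₂ τ.
    ... | σx₁-instance {m₁} a₁ q₁ w₁ | σx₁-instance {m₂} a₂ q₂ w₂
        with ⟨⟩-injective-or-ground m₁ m₂ τ (OnlyVar-⊑ a₁ (OnlyVar*-head onlyₘ))
                                           (λ y o → OnlyVar*-tail onlyₘ y (⊑-trans* o a₂)) (trans (sym q₁) q₂)
    ...   | inj₁ refl     = σx₁-instance (here a₁) q₁ (cong₂ _∷_ w₁ w₂)
    ...   | inj₂ (gr , i) =
            τx₁-ground gr (inj₂ ([ (λ p → here (⊑-trans p a₁)) , (λ p → there (⊑-trans* p a₂)) ]′ i))

transpose : Var → Var → Var → Var
transpose i j k with k ≟ i | k ≟ j
... | yes _ | _     = j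
... | no _  | yes _ = i
... | no _  | no _  = k

transpose-i : ∀ i j → transpose i j i ≡ j
transpose-i i j with i ≟ i
... | yes _  = refl
... | no i≢i = ⊥-elim (i≢i refl)

transpose-involutive : ∀ i j k → transpose i j (transpose i j k) ≡ k
transpose-involutive i j k with k ≟ i | k ≟ j
... | yes refl | _ = j↦i
  where j↦i : transpose k j j ≡ k
        j↦i with j ≟ k | j ≟ j
        ... | yes j≡k | _     = j≡k
        ... | no _    | yes _ = refl
        ... | no _    | no j≢j = ⊥-elim (j≢j refl)
... | no _ | yes refl = transpose-i i k
... | no k≢i | no k≢j with k ≟ i | k ≟ j
...   | yes k≡i | _       = ⊥-elim (k≢i k≡i)
...   | no _    | yes k≡j = ⊥-elim (k≢j k≡j)
...   | no _    | no _    = refl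

transpose-injective : ∀ i j {k l} → transpose i j k ≡ transpose i j l → k ≡ l
transpose-injective i j {k} {l} eq =
  trans (sym (transpose-involutive i j k)) (trans (cong (transpose i j) eq) (transpose-involutive i j l))

module _ {Sig : Signature} where

  _↦_ : Var → Term Sig → Subst
  (v ↦ u) w with w ≟ v
  ... | yes _ = u
  ... | no _  = var w

  ↦-hit : ∀ v (u : Term Sig) → (v ↦ u) v ≡ u
  ↦-hit v u with v ≟ v
  ... | yes _  = refl
  ... | no v≢v = ⊥-elim (v≢v refl)

  ↦-miss : ∀ {v w} (u : Term Sig) → w ≢ v → (v ↦ u) w ≡ var w
  ↦-miss {v} {w} u w≢v with w ≟ v
  ... | yes w≡v = ⊥-elim (w≢v w≡v)
  ... | no _    = refl

  unifier : ∀ {θ} {A B : Atom Sig} → pred A ≡ pred B → arg A ⟨ θ ⟩ ≡ arg B ⟨ θ ⟩ → Unifier θ A B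
  unifier = cong₂ _⦅_⦆

  IsMGU-sym : ∀ {σ} {A B : Atom Sig} → IsMGU σ A B → IsMGU σ B A
  IsMGU-sym (σ-unifies , most-general) = sym σ-unifies , λ θ θ-unifies → most-general θ (sym θ-unifies)

  IsMGU-var : ∀ {σ θ} {A B : Atom Sig} → IsMGU σ A B → Unifier θ A B
            → ∀ {w v} → θ w ≡ var v → ∃[ z ] (σ w ≡ var z)
  IsMGU-var {σ} {θ} (_ , most-general) θ-unifies {w} θw≡v with most-general θ θ-unifies
  ... | δ , θ≡σδ with σ w | θ≡σδ w
  ...   | var z    | _ = z , refl
  ...   | fun f ts | θw≡fun = case trans (sym θw≡v) θw≡fun of λ ()

  rename-involutiveˡ : ∀ {π : Var → Var} → (∀ x → π (π x) ≡ x) → ∀ (L : Literal Sig)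
                     → L ⟨ rename π ⟩ˡ ⟨ rename π ⟩ˡ ≡ L
  rename-involutiveˡ π-inv (lit s (P ⦅ t ⦆)) =
    cong (λ u → lit s (P ⦅ u ⦆)) (trans (⟨⟩-∘ t) (trans (⟨⟩-cong t λ x _ → cong var (π-inv x)) (⟨var⟩ t)))

  Unifier-⨟ : ∀ {σ} {A B : Atom Sig} → Unifier σ A B → ∀ τ → Unifier (σ ⨟ τ) A B
  Unifier-⨟ {σ} {A} {B} σ-unifies τ = unifier {σ ⨟ τ} {A} {B} (cong pred σ-unifies) (begin
    arg A ⟨ σ ⨟ τ ⟩   ≡⟨ ⟨⟩-∘ (arg A) ⟨
    arg A ⟨ σ ⟩ ⟨ τ ⟩ ≡⟨ cong (λ u → arg u ⟨ τ ⟩) σ-unifies ⟩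
    arg B ⟨ σ ⟩ ⟨ τ ⟩ ≡⟨ ⟨⟩-∘ (arg B) ⟩
    arg B ⟨ σ ⨟ τ ⟩   ∎)
    where open ≡-Reasoning

module _ {Sig : Signature} (S : List (Clause Sig)) (S-CaCb : ∀ C → C ∈ S → Ca C ⊎ Cb C) where

  private
    Tm : Set
    Tm = Term Sig

    Sub : Set
    Sub = Subst {Sig}

  Ngs[G] : Tm → Set
  Ngs[G] = Ngs S [ G S ]ˢ

  SubtermOfNg : Tm → Set
  SubtermOfNg m = ∃[ u ] (Ng S u × m ⊑ u)

  Ng-cases : ∀ {u} → Ng S u → u ≡ var x₁ ⊎ (ArgOf S u × OnlyVar x₁ u × NonGround u × Reduced u)
  Ng-cases (inj₁ u≡x₁) = inj₁ u≡x₁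
  Ng-cases (inj₂ (ng , C , L , C∈S , L∈C , refl)) with S-CaCb C C∈S
  ... | inj₁ ca      = ⊥-elim (ca L L∈C (proj₁ ng) (proj₂ ng))
  ... | inj₂ (_ , cb) = inj₂ ((C , L , C∈S , L∈C , refl) , cb L L∈C)

  Ng⇒x₁-only : ∀ {t} → Ng S t → Occurs x₁ t × OnlyVar x₁ t
  Ng⇒x₁-only ng with Ng-cases ng
  ... | inj₁ refl = ⊑-refl , λ { _ ⊑-refl → refl }
  ... | inj₂ (_ , only , (y , o) , _) with only y o
  ...   | refl = o , only

  Ng⇒Reduced : ∀ {t} → Ng S t → Reduced t
  Ng⇒Reduced ng with Ng-cases ng
  ... | inj₂ (_ , _ , _ , reduced) = reduced
  ... | inj₁ refl = λ { (fun f us , _ , _ , _ , ())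
                      ; (var y , _ , (_ , nontrivial , _) , _) → nontrivial (y , refl) }

  SubtermOfNg⇒OnlyVar : ∀ {m} → SubtermOfNg m → OnlyVar x₁ m
  SubtermOfNg⇒OnlyVar (u , ng , m⊑u) = OnlyVar-⊑ m⊑u (proj₂ (Ng⇒x₁-only ng))

  SubtermOfNg-⊑ : ∀ {m m′} → SubtermOfNg m → m′ ⊑ m → SubtermOfNg m′
  SubtermOfNg-⊑ (u , ng , m⊑u) m′⊑m = u , ng , ⊑-trans m′⊑m m⊑u

  Ngs⇒SubtermOfNg : ∀ {n} → Ngs S n → SubtermOfNg n
  Ngs⇒SubtermOfNg (inj₁ refl)                = var x₁ , inj₁ refl , ⊑-refl
  Ngs⇒SubtermOfNg (inj₂ (_ , u , ng , n⊑u)) = u , ng , n⊑u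

  Ground-SubtermOfNg⇒G : ∀ {g} → SubtermOfNg g → Ground g → G S g
  Ground-SubtermOfNg⇒G (u , ng , g⊑u) gr with Ng-cases ng
  ... | inj₂ (argOf , _) = gr , u , argOf , g⊑u
  ... | inj₁ refl with ⊑-var g⊑u
  ...   | refl = ⊥-elim (gr x₁ ⊑-refl)

  G-⊑ : ∀ {g h} → G S g → h ⊑ g → G S h
  G-⊑ (gr , u , argOf , g⊑u) h⊑g = (λ x o → gr x (⊑-trans o h⊑g)) , u , argOf , ⊑-trans h⊑g g⊑u

  G⇒Ngs[G] : ∀ {g} → G S g → Ngs[G] g
  G⇒Ngs[G] {g} Gg = var x₁ , g , inj₁ refl , Gg , refl

  Ngs[G]⇒Ground : ∀ {a} → Ngs[G] a → Ground a
  Ngs[G]⇒Ground (n , g , ngs , (gr , _) , refl) = Ground-⟨⟩ n (SubtermOfNg⇒OnlyVar (Ngs⇒SubtermOfNg ngs)) gr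

  SubtermOfNg[G]⇒Ngs[G] : ∀ {m r} → SubtermOfNg m → G S r → Ngs[G] (m [ r ])
  SubtermOfNg[G]⇒Ngs[G] {m} {r} sub Gr with occurs? x₁ m
  ... | yes o = m , r , inj₂ ((x₁ , o) , sub) , Gr , refl
  ... | no ¬o = var x₁ , m , inj₁ refl , Ground-SubtermOfNg⇒G sub gm , ground⇒⟨⟩-id m gm
    where gm = OnlyVar⇒Ground (SubtermOfNg⇒OnlyVar sub) ¬o

  ⊑-SubtermOfNg⟨G⟩⇒Ngs[G] : ∀ {m u} (τ : Subst) → SubtermOfNg m → G S (τ x₁) → u ⊑ m ⟨ τ ⟩ → Ngs[G] u
  ⊑-SubtermOfNg⟨G⟩⇒Ngs[G] {m} τ sub Gτx₁ u⊑mτ with ⊑⟨⟩⁻ m τ u⊑mτ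
  ... | inj₁ (m′ , m′⊑m , refl) =
        subst Ngs[G] (x₁-only-⟨⟩-cong m′ (SubtermOfNg⇒OnlyVar sub′) refl) (SubtermOfNg[G]⇒Ngs[G] sub′ Gτx₁)
    where sub′ = SubtermOfNg-⊑ sub m′⊑m
  ... | inj₂ (z , z∈m , u⊑τz) with SubtermOfNg⇒OnlyVar sub z z∈m
  ...   | refl = G⇒Ngs[G] (G-⊑ Gτx₁ u⊑τz)

  Ngs[G]-⊑ : ∀ {a u} → Ngs[G] a → u ⊑ a → Ngs[G] u
  Ngs[G]-⊑ (n , g , ngs , Gg , refl) = ⊑-SubtermOfNg⟨G⟩⇒Ngs[G] (sub₁ g) (Ngs⇒SubtermOfNg ngs) Gg

  data NgMatch (σ τ : Subst) (t m : Tm) : Set where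
    σx₁⊏τx₁   : σ x₁ ⊏ τ x₁ → NgMatch σ τ t m
    τx₁∈G     : G S (τ x₁) → NgMatch σ τ t m
    identical : m ≡ t → σ x₁ ≡ τ x₁ → NgMatch σ τ t m
    σx₁∈G     : G S (σ x₁) → NgMatch σ τ t m
    t-is-x₁   : t ≡ var x₁ → NgMatch σ τ t m

  private
    x₁-or-NGNT₁ : ∀ {t : Tm} → Occurs x₁ t → OnlyVar x₁ t → t ≡ var x₁ ⊎ NGNT₁ t
    x₁-or-NGNT₁ {var y}    o only with only y ⊑-refl
    ... | refl = inj₁ refl
    x₁-or-NGNT₁ {fun f ts} o only = inj₂ ((x₁ , o) , (λ { (_ , ()) }) , only)

  -- Reducedness of the elements of Ng rules out m = t [ m′ ] with t and m′ both non-trivial.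
  ng-match : (t m : Tm) (σ τ : Subst) → Ng S t → Ng S m → t ⟨ σ ⟩ ≡ m ⟨ τ ⟩ → NgMatch σ τ t m
  ng-match t m σ τ ngt ngm e with Ng⇒x₁-only ngt | Ng⇒x₁-only ngm
  ... | x₁∈t , onlyₜ | _ , onlyₘ with match t m σ τ onlyₜ onlyₘ e
  ... | σx₁⊏τx₁ p              = σx₁⊏τx₁ p
  ... | τx₁-ground gr (inj₁ p) = τx₁∈G (Ground-SubtermOfNg⇒G (t , ngt , p) gr)
  ... | τx₁-ground gr (inj₂ p) = τx₁∈G (Ground-SubtermOfNg⇒G (m , ngm , p) gr)
  ... | x₁-free w with onlyₘ 0 (subst (Occurs 0) (sym (w (var 0))) (occurs⇒⊑⟨⟩ (sub₁ (var 0)) x₁∈t))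
  ...   | ()
  ng-match t m σ τ ngt ngm e | _ | _ , onlyₘ | σx₁-instance {var z} m′⊑m σx₁≡m′τ w with onlyₘ z m′⊑m
  ... | refl = identical (trans w ([var-x₁] t)) σx₁≡m′τ
  ng-match t m σ τ ngt ngm e | x₁∈t , onlyₜ | _ , onlyₘ | σx₁-instance {fun f ms} m′⊑m σx₁≡m′τ w
    with occurs*? x₁ ms
  ... | no ¬o = σx₁∈G (subst (G S) (sym (trans σx₁≡m′τ (ground⇒⟨⟩-id (fun f ms) gr)))
                             (Ground-SubtermOfNg⇒G (m , ngm , m′⊑m) gr))
    where gr = OnlyVar⇒Ground (OnlyVar-⊑ m′⊑m onlyₘ) λ { (⊑-arg o) → ¬o o }
  ... | yes o with x₁-or-NGNT₁ x₁∈t onlyₜ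
  ...   | inj₁ t≡x₁ = t-is-x₁ t≡x₁
  ...   | inj₂ ngntₜ =
          ⊥-elim (Ng⇒Reduced ngm (t , fun f ms , ngntₜ , ngntₘ′ , w))
    where ngntₘ′ = (x₁ , ⊑-arg o) , (λ { (_ , ()) }) , OnlyVar-⊑ m′⊑m onlyₘ

  private
    anchors-in-Ngs[G] : ∀ (t s : Tm) (σ₁ σ₂ : Subst) → Ng S t → Ng S s → t ⟨ σ₁ ⟩ ≡ s ⟨ σ₂ ⟩
                      → G S (σ₁ x₁) → Ngs[G] (σ₁ x₁) × Ngs[G] (σ₂ x₁)
    anchors-in-Ngs[G] t s σ₁ σ₂ ngt ngs e Gσ₁x₁ =
      G⇒Ngs[G] Gσ₁x₁ ,
      ⊑-SubtermOfNg⟨G⟩⇒Ngs[G] σ₁ (t , ngt , ⊑-refl) Gσ₁x₁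
        (subst (σ₂ x₁ ⊑_) (sym e) (occurs⇒⊑⟨⟩ σ₂ (proj₁ (Ng⇒x₁-only ngs))))

  Ng-meets-Ng[Ngs[G]] : ∀ (t m r : Tm) (σ : Subst) → Ng S t → Ng S m → Ngs[G] r → t ⟨ σ ⟩ ≡ m [ r ]
                      → Ngs[G] (σ x₁) ⊎ t ≡ var x₁
  Ng-meets-Ng[Ngs[G]] t m r σ ngt ngm r∈ e with ng-match t m σ (sub₁ r) ngt ngm e
  ... | σx₁⊏τx₁ p      = inj₁ (Ngs[G]-⊑ r∈ (⊏⇒⊑ p))
  ... | τx₁∈G Gr       = inj₁ (proj₂ (anchors-in-Ngs[G] m t (sub₁ r) σ ngm ngt (sym e) Gr))
  ... | identical _ eq = inj₁ (subst Ngs[G] (sym eq) r∈)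
  ... | σx₁∈G Gσx₁     = inj₁ (G⇒Ngs[G] Gσx₁)
  ... | t-is-x₁ t≡x₁   = inj₂ t≡x₁

  Ng-meets-Ng : ∀ (t s : Tm) (σ₁ σ₂ : Subst) → Ng S t → Ng S s → t ⟨ σ₁ ⟩ ≡ s ⟨ σ₂ ⟩
              → (Ngs[G] (σ₁ x₁) × Ngs[G] (σ₂ x₁))
              ⊎ (s ≡ t × σ₁ x₁ ≡ σ₂ x₁) ⊎ t ≡ var x₁ ⊎ s ≡ var x₁
  Ng-meets-Ng t s σ₁ σ₂ ngt ngs e with ng-match t s σ₁ σ₂ ngt ngs e | ng-match s t σ₂ σ₁ ngs ngt (sym e)
  ... | τx₁∈G G₂           | _                 = inj₁ (swap (anchors-in-Ngs[G] s t σ₂ σ₁ ngs ngt (sym e) G₂))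
  ... | σx₁∈G G₁           | _                 = inj₁ (anchors-in-Ngs[G] t s σ₁ σ₂ ngt ngs e G₁)
  ... | identical s≡t eq   | _                 = inj₂ (inj₁ (s≡t , eq))
  ... | t-is-x₁ t≡x₁       | _                 = inj₂ (inj₂ (inj₁ t≡x₁))
  ... | σx₁⊏τx₁ _          | τx₁∈G G₁          = inj₁ (anchors-in-Ngs[G] t s σ₁ σ₂ ngt ngs e G₁)
  ... | σx₁⊏τx₁ _          | σx₁∈G G₂          = inj₁ (swap (anchors-in-Ngs[G] s t σ₂ σ₁ ngs ngt (sym e) G₂))
  ... | σx₁⊏τx₁ _          | identical t≡s eq  = inj₂ (inj₁ (sym t≡s , sym eq))
  ... | σx₁⊏τx₁ _          | t-is-x₁ s≡x₁      = inj₂ (inj₂ (inj₂ s≡x₁))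
  ... | σx₁⊏τx₁ p          | σx₁⊏τx₁ q         = ⊥-elim (⊏-irrefl (⊏-⊑-trans p (⊏⇒⊑ q)))

  Ng-meets-Ng-under-one-σ : ∀ (t s : Tm) (σ : Subst) → Ng S t → Ng S s → t ⟨ σ ⟩ ≡ s ⟨ σ ⟩
                          → Ngs[G] (σ x₁) ⊎ s ≡ t
  Ng-meets-Ng-under-one-σ t s σ ngt ngs e with ng-match t s σ σ ngt ngs e
  ... | σx₁⊏τx₁ p       = ⊥-elim (⊏-irrefl p)
  ... | τx₁∈G Gσx₁      = inj₁ (G⇒Ngs[G] Gσx₁)
  ... | σx₁∈G Gσx₁      = inj₁ (G⇒Ngs[G] Gσx₁)
  ... | identical s≡t _ = inj₂ s≡t
  ... | t-is-x₁ refl with proj₁ (Ng⇒x₁-only ngs)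
  ...   | ⊑-refl  = inj₂ refl
  ...   | ⊑-arg o = ⊥-elim (⊏-irrefl (subst (σ x₁ ⊏_) (sym e) (⊏-arg (occurs*⇒⊑⟨⟩ σ o))))

  CaArg CbArg : Tm → Set
  CaArg u = Ground u × AllowedArg S u
  CbArg u = OnlyVar x₁ u × NonGround u × Reduced u × AllowedArg S u

  Args : (Tm → Set) → Clause Sig → Set
  Args P C = ∀ L → L ∈ C → P (arg (atom L))

  CbArg⇒Ng : ∀ {u} → CbArg u → Ng S u
  CbArg⇒Ng (_ , _ , _ , inj₁ ng) = ng
  CbArg⇒Ng (_ , (y , o) , _ , inj₂ (m , n , ngm , n∈ , refl)) =
    ⊥-elim (Ground-⟨⟩ m (proj₂ (Ng⇒x₁-only ngm)) (Ngs[G]⇒Ground n∈) y o)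

  CaArg⇒Ng[Ngs[G]] : ∀ {u} → CaArg u → ∃[ m ] ∃[ r ] (Ng S m × Ngs[G] r × u ≡ m [ r ])
  CaArg⇒Ng[Ngs[G]] (gr , inj₁ ng)                        = ⊥-elim (gr x₁ (proj₁ (Ng⇒x₁-only ng)))
  CaArg⇒Ng[Ngs[G]] (gr , inj₂ (m , r , ngm , r∈ , u≡)) = m , r , ngm , r∈ , u≡

  Args⇒S† : ∀ {D} → Args CaArg D ⊎ Args CbArg D → S† S D
  Args⇒S† (inj₁ ca) = inj₁ (λ L L∈ → proj₁ (ca L L∈)) , λ L L∈ → proj₂ (ca L L∈)
  Args⇒S† {[]}    (inj₂ cb) = inj₁ (λ _ ()) , λ _ ()
  Args⇒S† {L ∷ D} (inj₂ cb) with cb L (hereˡ refl)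
  ... | only , (y , o) , _ with only y o
  ...   | refl = inj₂ ((L , hereˡ refl , o) , λ L′ L′∈ → let (a , b , c , _) = cb L′ L′∈ in a , b , c)
               , λ L′ L′∈ → proj₂ (proj₂ (proj₂ (cb L′ L′∈)))

  x₁⇄ : Var → Sub
  x₁⇄ z = rename (transpose z x₁)

  in-S†-up-to-renaming : ∀ R z
    → Args (CaArg ∘ _⟨ x₁⇄ z ⟩) R ⊎ Args (CbArg ∘ _⟨ x₁⇄ z ⟩) R
    → InS†UpToRenaming S R
  in-S†-up-to-renaming R z args =
    R ⟨ π ⟩ᶜ , Args⇒S† (⊎-map back back args) , transpose z x₁ , (λ _ _ → transpose-injective z x₁) ,
    λ L → subst (L ∈_) (sym R≡) , subst (L ∈_) R≡
    where
      π = x₁⇄ z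
      back : ∀ {P} → Args (P ∘ _⟨ π ⟩) R → Args P (R ⟨ π ⟩ᶜ)
      back args L L∈ with ∈-map⁻ _ L∈
      ... | L₀ , L₀∈ , refl = args L₀ L₀∈
      R≡ : R ⟨ π ⟩ᶜ ⟨ π ⟩ᶜ ≡ R
      R≡ = trans (sym (map-∘ R)) (trans (map-cong (rename-involutiveˡ (transpose-involutive z x₁)) R) (map-id R))

  original-arg : ∀ {C C′ : Clause Sig} (ren : RenamingOf C C′) {L} → L ∈ C
               → ∃[ L₀ ] (L₀ ∈ C′ × arg (atom L) ≡ arg (atom L₀) ⟨ rename (proj₁ ren) ⟩)
  original-arg (_ , _ , C≈) {L} L∈C with ∈-map⁻ _ (proj₁ (C≈ L) L∈C)
  ... | L₀ , L₀∈ , refl = L₀ , L₀∈ , refl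

  module Premise {C C′ : Clause Sig} (C′∈S† : S† S C′) (ren : RenamingOf C C′) where

    ρ : Var → Var
    ρ = proj₁ ren

    Ca-args : Ca C′ → ∀ (θ : Sub) → Args (CaArg ∘ _⟨ θ ⟩) C
    Ca-args ca θ L L∈ with original-arg ren L∈
    ... | L₀ , L₀∈ , refl = subst CaArg (sym l₀ρθ≡l₀) (gr , proj₂ C′∈S† L₀ L₀∈)
      where
        gr = ca L₀ L₀∈
        l₀ρθ≡l₀ : arg (atom L₀) ⟨ rename ρ ⟩ ⟨ θ ⟩ ≡ arg (atom L₀)
        l₀ρθ≡l₀ = trans (⟨⟩-∘ (arg (atom L₀))) (ground⇒⟨⟩-id (arg (atom L₀)) gr)

    Cb-arg : Cb C′ → ∀ {L₀} → L₀ ∈ C′ → CbArg (arg (atom L₀))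
    Cb-arg cb L₀∈ = let (only , ng , reduced) = proj₂ cb _ L₀∈ in only , ng , reduced , proj₂ C′∈S† _ L₀∈

    Cb-instance : Cb C′ → ∀ (θ : Sub) {L} → L ∈ C
                → ∃[ l₀ ] (CbArg l₀ × arg (atom L) ⟨ θ ⟩ ≡ l₀ [ θ (ρ x₁) ])
    Cb-instance cb θ {L} L∈ with original-arg ren L∈
    ... | L₀ , L₀∈ , refl = l₀ , Cb-arg cb L₀∈ , (begin
          l₀ ⟨ rename ρ ⟩ ⟨ θ ⟩ ≡⟨ ⟨⟩-∘ l₀ ⟩
          l₀ ⟨ rename ρ ⨟ θ ⟩   ≡⟨ x₁-only-⟨⟩-cong l₀ (proj₁ (Cb-arg cb L₀∈)) refl ⟩
          l₀ [ θ (ρ x₁) ]       ∎)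
      where open ≡-Reasoning
            l₀ = arg (atom L₀)

    Cb-args-ground : Cb C′ → ∀ (θ : Sub) → Ngs[G] (θ (ρ x₁)) → Args (CaArg ∘ _⟨ θ ⟩) C
    Cb-args-ground cb θ a∈ L L∈ with Cb-instance cb θ L∈
    ... | l₀ , l₀-arg , eq =
          subst CaArg (sym eq)
            (Ground-⟨⟩ l₀ (proj₁ l₀-arg) (Ngs[G]⇒Ground a∈) , inj₂ (l₀ , _ , CbArg⇒Ng l₀-arg , a∈ , refl))

    Cb-args-x₁ : Cb C′ → ∀ (θ : Sub) → θ (ρ x₁) ≡ var x₁ → Args (CbArg ∘ _⟨ θ ⟩) C
    Cb-args-x₁ cb θ θρx₁≡x₁ L L∈ with Cb-instance cb θ L∈
    ... | l₀ , l₀-arg , eq = subst CbArg (sym (trans eq (trans (cong (l₀ [_]) θρx₁≡x₁) ([var-x₁] l₀)))) l₀-arg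

    x₁-occurs : Cb C′ → ∀ {L} → L ∈ C → Occurs (ρ x₁) (arg (atom L))
    x₁-occurs cb L∈ with original-arg ren L∈
    ... | L₀ , L₀∈ , refl with Cb-arg cb L₀∈
    ...   | only , (y , o) , _ with only y o
    ...     | refl = occurs⇒⊑⟨⟩ (rename ρ) o

    -- Every argument of C contains ρ x₁, so maximality of P(ρ x₁) forces all of them to be ρ x₁.
    collapsed-args : Cb C′ → ∀ {s A} → lit s A ∈ C → Maximal A C → arg A ≡ var (ρ x₁)
                   → ∀ {P} (θ : Sub) → P (arg A ⟨ θ ⟩) → Args (P ∘ _⟨ θ ⟩) C
    collapsed-args cb A∈ maximal argA≡ {P} θ pA L L∈ =
      subst (λ u → P (u ⟨ θ ⟩)) (sym (trans argL≡ (sym argA≡))) pA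
      where argL≡ : arg (atom L) ≡ var (ρ x₁)
            argL≡ = ⊑-¬⊏⇒≡ (x₁-occurs cb L∈)
                      λ ρx₁⊏ → maximal L L∈ (subst (_⊏ arg (atom L)) (sym argA≡) ρx₁⊏)

  record Side (C : Clause Sig) (A : Atom Sig) : Set where
    field
      {original}  : Clause Sig
      original∈S† : S† S original
      renamed     : RenamingOf C original
      {sign}      : Sign
      selected    : lit sign A ∈ C
      maximal     : Maximal A C

    open Premise original∈S† renamed public

    private
      origin = original-arg renamed selected

    t₀ : Tm
    t₀ = arg (atom (proj₁ origin))

    arg-selected : arg A ≡ t₀ ⟨ rename ρ ⟩
    arg-selected = proj₂ (proj₂ origin)

    arg-selected-⟨⟩ : ∀ (θ : Sub) → arg A ⟨ θ ⟩ ≡ t₀ ⟨ rename ρ ⨟ θ ⟩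
    arg-selected-⟨⟩ θ = trans (cong _⟨ θ ⟩ arg-selected) (⟨⟩-∘ t₀)

    t₀-CaArg : Ca original → CaArg t₀
    t₀-CaArg ca = ca _ (proj₁ (proj₂ origin)) , proj₂ original∈S† _ (proj₁ (proj₂ origin))

    t₀-Ng : Cb original → Ng S t₀
    t₀-Ng cb = CbArg⇒Ng (Cb-arg cb (proj₁ (proj₂ origin)))

    t₀-only : Cb original → OnlyVar x₁ t₀
    t₀-only cb = proj₁ (Cb-arg cb (proj₁ (proj₂ origin)))

  x₁⇄-anchor : ∀ {a : Tm} {z} → a ≡ var z → a ⟨ x₁⇄ z ⟩ ≡ var x₁
  x₁⇄-anchor {z = z} eq = trans (cong _⟨ x₁⇄ z ⟩ eq) (cong var (transpose-i z x₁))

  Ngs[G]-⟨⟩ : ∀ {a} (τ : Sub) → Ngs[G] a → Ngs[G] (a ⟨ τ ⟩)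
  Ngs[G]-⟨⟩ τ a∈ = subst Ngs[G] (sym (ground⇒⟨⟩-id _ (Ngs[G]⇒Ground a∈))) a∈

  CaOrCbAfter : Sub → Clause Sig → Clause Sig → Set
  CaOrCbAfter θ C D = (Args (CaArg ∘ _⟨ θ ⟩) C × Args (CaArg ∘ _⟨ θ ⟩) D)
               ⊎ (Args (CbArg ∘ _⟨ θ ⟩) C × Args (CbArg ∘ _⟨ θ ⟩) D)

  CaOrCbAfter-sym : ∀ {θ C D} → CaOrCbAfter θ C D → CaOrCbAfter θ D C
  CaOrCbAfter-sym = ⊎-map swap swap

  module SidePair {C D A B} {σ : Sub} (c : Side C A) (d : Side D B) (mgu : IsMGU σ A B) where

    private
      module c = Side c
      module d = Side d

    selected-args : c.t₀ ⟨ rename c.ρ ⨟ σ ⟩ ≡ d.t₀ ⟨ rename d.ρ ⨟ σ ⟩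
    selected-args = trans (sym (c.arg-selected-⟨⟩ σ)) (trans (cong arg (proj₁ mgu)) (d.arg-selected-⟨⟩ σ))

    private
      selected-args-⨟ : ∀ τ → arg A ⟨ σ ⨟ τ ⟩ ≡ arg B ⟨ σ ⨟ τ ⟩
      selected-args-⨟ τ = cong arg (Unifier-⨟ {A = A} {B} (proj₁ mgu) τ)

    Ca-vs-Cb : Ca c.original → Cb d.original → CaOrCbAfter (σ ⨟ x₁⇄ x₁) C D
    Ca-vs-Cb ca cb with CaArg⇒Ng[Ngs[G]] (c.t₀-CaArg ca)
    ... | m , r , ngm , r∈ , t₀≡m[r]
        with Ng-meets-Ng[Ngs[G]] d.t₀ m r (rename d.ρ ⨟ σ) (d.t₀-Ng cb) ngm r∈
               (trans (sym selected-args) (trans (ground⇒⟨⟩-id c.t₀ (proj₁ (c.t₀-CaArg ca))) t₀≡m[r]))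
    ... | inj₁ anchor∈ = inj₁ (C-args , d.Cb-args-ground cb _ (Ngs[G]-⟨⟩ (x₁⇄ x₁) anchor∈))
      where C-args = c.Ca-args ca (σ ⨟ x₁⇄ x₁)
    ... | inj₂ s₀≡x₁ =
          inj₁ (C-args , d.collapsed-args cb d.selected d.maximal argB≡ {CaArg} _
                           (subst CaArg (selected-args-⨟ _) (C-args _ c.selected)))
      where C-args = c.Ca-args ca (σ ⨟ x₁⇄ x₁)
            argB≡ = trans d.arg-selected (cong _⟨ rename d.ρ ⟩ s₀≡x₁)

    -- C and D are renamed apart, so c.ρ x₁ ↦ arg B is a unifier fixing the variable
    -- d.ρ x₁ of D; hence σ sends d.ρ x₁ to a variable z.
    C-collapses : Cb c.original → Cb d.original → RenamedApart C D → c.t₀ ≡ var x₁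
                → ∃[ z ] CaOrCbAfter (σ ⨟ x₁⇄ z) C D
    C-collapses cbc cbd apart t₀≡x₁ =
      let (z , σρ′x₁≡z) = IsMGU-var {σ = σ} {A = A} {B = B} mgu θ-unifies (↦-miss (arg B) ρ′x₁≢ρx₁)
          D-args = d.Cb-args-x₁ cbd (σ ⨟ x₁⇄ z) (x₁⇄-anchor σρ′x₁≡z)
      in z , inj₂ (c.collapsed-args cbc c.selected c.maximal argA≡ {CbArg} _
                     (subst CbArg (sym (selected-args-⨟ _)) (D-args _ d.selected)) , D-args)
      where
        open ≡-Reasoning
        argA≡ : arg A ≡ var (c.ρ x₁)
        argA≡ = trans c.arg-selected (cong _⟨ rename c.ρ ⟩ t₀≡x₁)
        ρ′x₁≢ρx₁ : d.ρ x₁ ≢ c.ρ x₁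
        ρ′x₁≢ρx₁ eq = apart (c.ρ x₁) (_ , c.selected , subst (Occurs _) (sym argA≡) ⊑-refl)
                                     (_ , d.selected , subst (λ v → Occurs v (arg B)) eq (d.x₁-occurs cbd d.selected))
        θ : Sub
        θ = c.ρ x₁ ↦ arg B
        θ-unifies : Unifier θ A B
        θ-unifies = unifier {θ = θ} {A = A} {B = B} (cong pred (proj₁ mgu)) (begin
          arg A ⟨ θ ⟩             ≡⟨ cong _⟨ θ ⟩ argA≡ ⟩
          θ (c.ρ x₁)              ≡⟨ ↦-hit _ _ ⟩
          arg B                   ≡⟨ d.arg-selected ⟩
          d.t₀ ⟨ rename d.ρ ⟩     ≡⟨ x₁-only-⟨⟩-cong d.t₀ (d.t₀-only cbd) (sym (↦-miss _ ρ′x₁≢ρx₁)) ⟩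
          d.t₀ ⟨ rename d.ρ ⨟ θ ⟩ ≡⟨ d.arg-selected-⟨⟩ θ ⟨
          arg B ⟨ θ ⟩             ∎)

    identical-anchors : Cb c.original → Cb d.original → d.t₀ ≡ c.t₀ → σ (c.ρ x₁) ≡ σ (d.ρ x₁)
                      → ∃[ z ] CaOrCbAfter (σ ⨟ x₁⇄ z) C D
    identical-anchors cbc cbd s₀≡t₀ anchors≡ =
      let (z , σρx₁≡z) = IsMGU-var {σ = σ} {A = A} {B = B} mgu θ-unifies refl
      in z , inj₂ (c.Cb-args-x₁ cbc _ (x₁⇄-anchor σρx₁≡z)
                  , d.Cb-args-x₁ cbd _ (x₁⇄-anchor (trans (sym anchors≡) σρx₁≡z)))
      where
        θ : Sub
        θ _ = var (c.ρ x₁)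
        θ-unifies : Unifier θ A B
        θ-unifies = unifier {θ = θ} {A = A} {B = B} (cong pred (proj₁ mgu))
          (trans (c.arg-selected-⟨⟩ θ) (trans (cong _⟨ θ ⟩ (sym s₀≡t₀)) (sym (d.arg-selected-⟨⟩ θ))))

  Cb-vs-Cb : ∀ {C D A B} {σ : Sub} (c : Side C A) (d : Side D B) → IsMGU σ A B
           → Cb (Side.original c) → Cb (Side.original d) → RenamedApart C D → ∃[ z ] CaOrCbAfter (σ ⨟ x₁⇄ z) C D
  Cb-vs-Cb {A = A} {B} {σ} c d mgu cbc cbd apart
    with Ng-meets-Ng c.t₀ d.t₀ (rename c.ρ ⨟ σ) (rename d.ρ ⨟ σ) (c.t₀-Ng cbc) (d.t₀-Ng cbd)
                     (SidePair.selected-args c d mgu)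
    where module c = Side c
          module d = Side d
  ... | inj₁ (a∈ , b∈) =
        x₁ , inj₁ ( Side.Cb-args-ground c cbc _ (Ngs[G]-⟨⟩ (x₁⇄ x₁) a∈)
                  , Side.Cb-args-ground d cbd _ (Ngs[G]-⟨⟩ (x₁⇄ x₁) b∈))
  ... | inj₂ (inj₁ (s₀≡t₀ , anchors≡)) = SidePair.identical-anchors c d mgu cbc cbd s₀≡t₀ anchors≡
  ... | inj₂ (inj₂ (inj₁ t₀≡x₁))        = SidePair.C-collapses c d mgu cbc cbd apart t₀≡x₁
  ... | inj₂ (inj₂ (inj₂ s₀≡x₁))        =
        map₂ CaOrCbAfter-sym
          (SidePair.C-collapses d c (IsMGU-sym {σ = σ} {A = A} {B = B} mgu) cbd cbc (λ x o o′ → apart x o′ o) s₀≡x₁)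

  resolution-CaOrCb : ∀ {C D A B} {σ : Sub} (c : Side C A) (d : Side D B) → IsMGU σ A B → RenamedApart C D
                    → ∃[ z ] CaOrCbAfter (σ ⨟ x₁⇄ z) C D
  resolution-CaOrCb {A = A} {B} {σ} c d mgu apart with proj₁ (Side.original∈S† c) | proj₁ (Side.original∈S† d)
  ... | inj₁ cac | inj₁ cad = x₁ , inj₁ (Side.Ca-args c cac _ , Side.Ca-args d cad _)
  ... | inj₁ ca  | inj₂ cb  = x₁ , SidePair.Ca-vs-Cb c d mgu ca cb
  ... | inj₂ cb  | inj₁ ca  = x₁ , CaOrCbAfter-sym (SidePair.Ca-vs-Cb d c (IsMGU-sym {σ = σ} {A = A} {B = B} mgu) ca cb)
  ... | inj₂ cbc | inj₂ cbd = Cb-vs-Cb c d mgu cbc cbd apart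

  reselect : ∀ {C A B s} → Side C A → lit s B ∈ C → Maximal B C → Side C B
  reselect c B∈ maxB =
    record { original∈S† = Side.original∈S† c ; renamed = Side.renamed c ; selected = B∈ ; maximal = maxB }

  factoring-CaOrCb : ∀ {C A B s} {σ : Sub} (c : Side C A) (B∈ : lit s B ∈ C) (maxB : Maximal B C) → IsMGU σ A B
                   → ∃[ z ] (Args (CaArg ∘ _⟨ σ ⨟ x₁⇄ z ⟩) C ⊎ Args (CbArg ∘ _⟨ σ ⨟ x₁⇄ z ⟩) C)
  factoring-CaOrCb {A = A} {B} {σ = σ} c B∈ maxB mgu with proj₁ (Side.original∈S† c)
  ... | inj₁ ca = x₁ , inj₁ (Side.Ca-args c ca _)
  ... | inj₂ cb
      with Ng-meets-Ng-under-one-σ c.t₀ b.t₀ (rename c.ρ ⨟ σ) (c.t₀-Ng cb) (b.t₀-Ng cb)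
                                   (SidePair.selected-args c b mgu)
    where module c = Side c
          b = reselect c B∈ maxB
          module b = Side b
  ...   | inj₁ a∈ = x₁ , inj₁ (Side.Cb-args-ground c cb _ (Ngs[G]-⟨⟩ (x₁⇄ x₁) a∈))
  ...   | inj₂ s₀≡t₀ =
          let (z , σρx₁≡z) = IsMGU-var {σ = σ} {A = A} {B = B} mgu var-unifies refl
          in z , inj₂ (Side.Cb-args-x₁ c cb _ (x₁⇄-anchor σρx₁≡z))
    where
      var-unifies : Unifier var A B
      var-unifies = unifier {θ = var} {A = A} {B = B} (cong pred (proj₁ mgu)) (cong _⟨ var ⟩
        (trans (Side.arg-selected c) (trans (cong _⟨ rename (Side.ρ c) ⟩ (sym s₀≡t₀))
          (sym (Side.arg-selected (reselect c B∈ maxB))))))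

  Args-from-premises : ∀ {P} {σ τ : Sub} {R : Clause Sig} (Src : Literal Sig → Set)
    → (∀ L → L ∈ R → ∃[ L′ ] (Src L′ × L ≡ L′ ⟨ σ ⟩ˡ))
    → (∀ L′ → Src L′ → P (arg (atom L′) ⟨ σ ⨟ τ ⟩))
    → Args (P ∘ _⟨ τ ⟩) R
  Args-from-premises {P} Src R⊆ src-args L L∈ with R⊆ L L∈
  ... | L′ , src , refl = subst P (sym (⟨⟩-∘ (arg (atom L′)))) (src-args L′ src)

  resolvent-in-S† : ∀ C D C′ D′ R → S† S C′ → S† S D′
                  → RenamingOf C C′ → RenamingOf D D′ → RenamedApart C D
                  → Resolvent C D R → InS†UpToRenaming S R
  resolvent-in-S† C D C′ D′ R C′∈ D′∈ renC renD apart (A , B , σ , A∈ , B∈ , maxA , maxB , mgu , R≈) =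
    let (z , args) = resolution-CaOrCb c d mgu apart
    in in-S†-up-to-renaming R z (⊎-map (uncurry (from-C-or-D {CaArg})) (uncurry (from-C-or-D {CbArg})) args)
    where
      c : Side C A
      c = record { original∈S† = C′∈ ; renamed = renC ; selected = A∈ ; maximal = maxA }
      d : Side D B
      d = record { original∈S† = D′∈ ; renamed = renD ; selected = B∈ ; maximal = maxB }
      R⊆ : ∀ L → L ∈ R → ∃[ L′ ] ((L′ ∈ C ⊎ L′ ∈ D) × L ≡ L′ ⟨ σ ⟩ˡ)
      R⊆ L L∈ with proj₁ (R≈ L) L∈
      ... | inj₁ (L′ , L′∈ , _ , eq) = L′ , inj₁ L′∈ , eq
      ... | inj₂ (L′ , L′∈ , _ , eq) = L′ , inj₂ L′∈ , eq
      from-C-or-D : ∀ {P τ} → Args (P ∘ _⟨ σ ⨟ τ ⟩) C → Args (P ∘ _⟨ σ ⨟ τ ⟩) D → Args (P ∘ _⟨ τ ⟩) R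
      from-C-or-D {P} {τ} C-args D-args =
        Args-from-premises {P} {σ} {τ} _ R⊆ λ { L′ (inj₁ L′∈) → C-args L′ L′∈ ; L′ (inj₂ L′∈) → D-args L′ L′∈ }

  factor-in-S† : ∀ C C′ R → S† S C′ → RenamingOf C C′ → Factor C R → InS†UpToRenaming S R
  factor-in-S† C C′ R C′∈ renC (s , A , B , σ , A∈ , B∈ , maxA , maxB , mgu , R≈) =
    let (z , args) = factoring-CaOrCb c B∈ maxB mgu
    in in-S†-up-to-renaming R z (⊎-map (from-C {CaArg}) (from-C {CbArg}) args)
    where
      c : Side C A
      c = record { original∈S† = C′∈ ; renamed = renC ; selected = A∈ ; maximal = maxA }
      R⊆ : ∀ L → L ∈ R → ∃[ L′ ] (L′ ∈ C × L ≡ L′ ⟨ σ ⟩ˡ)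
      R⊆ L L∈ with proj₁ (R≈ L) L∈
      ... | inj₁ (L′ , L′∈ , _ , _ , eq) = L′ , L′∈ , eq
      ... | inj₂ eq                      = lit s A , A∈ , eq
      from-C : ∀ {P τ} → Args (P ∘ _⟨ σ ⨟ τ ⟩) C → Args (P ∘ _⟨ τ ⟩) R
      from-C {P} {τ} C-args = Args-from-premises {P} {σ} {τ} _ R⊆ C-args

lemma5 : (Sig : Signature) (S : List (Clause Sig))
  → (∀ C → C ∈ S → Ca C ⊎ Cb C)
  → (∀ C D C′ D′ R
       → S† S C′ → S† S D′
       → RenamingOf C C′ → RenamingOf D D′ → RenamedApart C D
       → Resolvent C D R
       → InS†UpToRenaming S R)
  × (∀ C C′ R
       → S† S C′ → RenamingOf C C′
       → Factor C R
       → InS†UpToRenaming S R)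
lemma5 Sig S S-CaCb = resolvent-in-S† S S-CaCb , factor-in-S† S S-CaCb
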